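{- Let $k$ be a positive integer and let $P$ be a north--east lattice path, i.e., a finite sequence of points $p_0,p_1,\dots,p_m\in\mathbb{Z}^2$ with $p_{j+1}-p_j\in\{(1,0),(0,1)\}$ for each $j$. Suppose $P$ never takes $k-1$ consecutive steps in the same direction (i.e., there is no $j$ with $p_{j+1}-p_j=p_{j+2}-p_{j+1}=\dots=p_{j+k-1}-p_{j+k-2}$). Then for every real number $s>k-2$, there is no (non-vertical) line of slope $s$ in the plane that contains $k$ distinct points of $P$.
   Context: A step $(0,1)$ is called a north step and a step $(1,0)$ an east step. The points of the path are the lattice points $p_0,\dots,p_m$ it visits.
   Formalization: The slope s and the intercept of the line range over the rationals rather than the reals. -}

module Defs where

open import Data.Nat using (ℕ; suc; _<_; _≤_; _+_; _∸_)
open import Data.Integer as ℤ using (ℤ; +_)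
open import Data.Rational as ℚ using (ℚ)
open import Data.Product using (_×_; _,_; proj₁; proj₂; ∃)
open import Data.Sum using (_⊎_)
open import Data.Fin using (Fin)
open import Relation.Binary.PropositionalEquality using (_≡_)
open import Relation.Nullary using (¬_)

Point : Set
Point = ℤ × ℤ

_⊖_ : Point → Point → Point
(a , b) ⊖ (c , d) = (a ℤ.- c , b ℤ.- d)

east north : Point
east  = (+ 1 , + 0)
north = (+ 0 , + 1)

-- A north-east lattice path with points p 0, …, p m
-- (the values of p beyond m are irrelevant).
IsNEPath : (m : ℕ) → (ℕ → Point) → Set
IsNEPath m p = ∀ j → j < m → (p (suc j) ⊖ p j ≡ east) ⊎ (p (suc j) ⊖ p j ≡ north)

stepAt : (ℕ → Point) → ℕ → Point
stepAt p j = p (suc j) ⊖ p j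

HasRun : (k m : ℕ) → (ℕ → Point) → Set
HasRun k m p = ∃ λ j → (j + (k ∸ 1) ≤ m) × (∀ i → i < k ∸ 1 → stepAt p (j + i) ≡ stepAt p j)

ι : ℤ → ℚ
ι z = z ℚ./ 1

OnLine : ℚ → ℚ → Point → Set
OnLine s c (x , y) = ι y ≡ s ℚ.* ι x ℚ.+ c

LineContains : (k m : ℕ) → (ℕ → Point) → ℚ → ℚ → Set
LineContains k m p s c =
  ∃ λ (idx : Fin k → ℕ) →
    (∀ a → idx a ≤ m) ×
    (∀ a b → p (idx a) ≡ p (idx b) → a ≡ b) ×
    (∀ a → OnLine s c (p (idx a)))

-- Consider the tilt ψ(x , y) = y − (k − 2) x.  On a line of slope s > k − 2 we have
-- ψ = (s − (k − 2)) x + const, so ψ is strictly increasing in x and takes k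
-- distinct integer values on k points of the line.  Along the path a north step
-- raises ψ by 1 and an east step lowers it by k − 2; since north runs have
-- length at most k − 2, ψ never exceeds its value at an earlier point by more
-- than k − 2.  Starting from the earliest of the k points, x only grows, so ψ
-- does not drop below its value there either: k distinct values would have to
-- fit into a window of k − 1 integers.
module Submission where

open import Defs
open import Data.Nat using (ℕ; _≥_)
open import Data.Integer using (+_; _-_)
open import Data.Rational using (ℚ; _>_)
open import Relation.Nullary using (¬_)

open import Data.Nat as ℕ using (zero; suc; z≤n; s≤s; _≤′_; ≤′-refl; ≤′-step)
import Data.Nat.Properties as ℕP
open import Data.Integer as ℤ using (ℤ)
import Data.Integer.Properties as ℤP
import Data.Integer.Solver as ℤSolver
open import Data.Rational as ℚ using (mkℚ)
import Data.Rational.Properties as ℚP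
import Data.Rational.Solver as ℚSolver
open import Data.Nat.Coprimality as Coprime using (1-coprimeTo)
open import Data.Fin as Fin using (Fin; fromℕ<)
import Data.Fin.Properties as FinP
open import Data.List using (allFin)
import Data.List.Relation.Unary.All as All
open import Data.List.Membership.Propositional.Properties using (∈-allFin)
open import Data.List.Extrema ℕP.≤-totalOrder using (argmin; f[argmin]≤f[xs])
open import Data.Product using (_×_; _,_; proj₁; proj₂)
open import Data.Sum using (inj₁; inj₂)
open import Relation.Nullary using (yes; no)
open import Data.Empty using (⊥-elim)
open import Function using (_∘_)
open import Relation.Binary.Definitions using (tri<; tri≈; tri>)
open import Relation.Binary.PropositionalEquality

ι≡mkℚ : ∀ a → ι a ≡ mkℚ a 0 (Coprime.sym (1-coprimeTo ℤ.∣ a ∣))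
ι≡mkℚ a = ℚP.↥p/↧p≡p (mkℚ a 0 _)

ι-homo-+ : ∀ a b → ι (a ℤ.+ b) ≡ ι a ℚ.+ ι b
ι-homo-+ a b = trans
  (cong₂ (λ u v → (u ℤ.+ v) ℚ./ 1) (sym (ℤP.*-identityʳ a)) (sym (ℤP.*-identityʳ b)))
  (sym (cong₂ ℚ._+_ (ι≡mkℚ a) (ι≡mkℚ b)))

ι-homo-* : ∀ a b → ι (a ℤ.* b) ≡ ι a ℚ.* ι b
ι-homo-* a b = sym (cong₂ ℚ._*_ (ι≡mkℚ a) (ι≡mkℚ b))

ι-injective : ∀ {a b} → ι a ≡ ι b → a ≡ b
ι-injective {a} {b} ιa≡ιb = cong ℚ.↥_ (trans (sym (ι≡mkℚ a)) (trans ιa≡ιb (ι≡mkℚ b)))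

ι-mono-< : ∀ {a b} → a ℤ.< b → ι a ℚ.< ι b
ι-mono-< {a} {b} a<b = subst₂ ℚ._<_ (sym (ι≡mkℚ a)) (sym (ι≡mkℚ b))
  (ℚ.*<* (subst₂ ℤ._<_ (sym (ℤP.*-identityʳ a)) (sym (ℤP.*-identityʳ b)) a<b))

ι-cancel-< : ∀ {a b} → ι a ℚ.< ι b → a ℤ.< b
ι-cancel-< {a} {b} ιa<ιb with subst₂ ℚ._<_ (ι≡mkℚ a) (ι≡mkℚ b) ιa<ιb
... | ℚ.*<* a*1<b*1 = subst₂ ℤ._<_ (ℤP.*-identityʳ a) (ℤP.*-identityʳ b) a*1<b*1

p<q⇒0<q-p : ∀ {p q} → p ℚ.< q → ℚ.0ℚ ℚ.< q ℚ.- p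
p<q⇒0<q-p {p} {q} p<q = subst (ℚ._< q ℚ.- p) (ℚP.+-inverseʳ p) (ℚP.+-monoˡ-< (ℚ.- p) p<q)

tilt : ℤ → Point → ℤ
tilt t (x , y) = y ℤ.- t ℤ.* x

module _ where
  open ℤSolver.+-*-Solver

  y≡tilt+t*x : ∀ t x y → y ≡ tilt t (x , y) ℤ.+ t ℤ.* x
  y≡tilt+t*x = solve 3 (λ t x y → y := (y :- t :* x) :+ t :* x) refl

  tilt-⊖ : ∀ t P Q → tilt t P ≡ tilt t Q ℤ.+ tilt t (P ⊖ Q)
  tilt-⊖ t (a , b) (c , d) = solve 5 (λ t a b c d →
    b :- t :* a := (d :- t :* c) :+ ((b :- d) :- t :* (a :- c))) refl t a b c d

  tilt-east : ∀ t → tilt t east ≡ ℤ.- t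
  tilt-east = solve 1 (λ t → con (+ 0) :- t :* con (+ 1) := :- t) refl

  tilt-north : ∀ t → tilt t north ≡ + 1
  tilt-north = solve 1 (λ t → con (+ 1) :- t :* con (+ 0) := con (+ 1)) refl

  [a+b]-b≡a : ∀ a b → (a ℤ.+ b) ℤ.- b ≡ a
  [a+b]-b≡a = solve 2 (λ a b → (a :+ b) :- b := a) refl

  [a+b]-a≡b : ∀ a b → (a ℤ.+ b) ℤ.- a ≡ b
  [a+b]-a≡b = solve 2 (λ a b → (a :+ b) :- a := b) refl

  [a-b]+b≡a : ∀ a b → (a ℤ.- b) ℤ.+ b ≡ a
  [a-b]+b≡a = solve 2 (λ a b → (a :- b) :+ b := a) refl

  x-⊖ : ∀ P Q → proj₁ P ≡ proj₁ Q ℤ.+ proj₁ (P ⊖ Q)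
  x-⊖ (a , _) (c , _) = solve 2 (λ a c → a := c :+ (a :- c)) refl a c

module OnLineLemmas (s c : ℚ) where

  ι-tilt-onLine : ∀ t x y → OnLine s c (x , y) →
                  ι (tilt t (x , y)) ≡ (s ℚ.- ι t) ℚ.* ι x ℚ.+ c
  ι-tilt-onLine t x y onLine = begin
    ι u                                     ≡⟨ a≡[a+b]-b (ι u) (ι t ℚ.* ι x) ⟩
    (ι u ℚ.+ ι t ℚ.* ι x) ℚ.- ι t ℚ.* ι x  ≡⟨ cong (ℚ._- ι t ℚ.* ι x) ι-split ⟨
    ι y ℚ.- ι t ℚ.* ι x                    ≡⟨ cong (ℚ._- ι t ℚ.* ι x) onLine ⟩
    (s ℚ.* ι x ℚ.+ c) ℚ.- ι t ℚ.* ι x      ≡⟨ collect s (ι x) c (ι t) ⟩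
    (s ℚ.- ι t) ℚ.* ι x ℚ.+ c               ∎
    where
    open ≡-Reasoning
    open ℚSolver.+-*-Solver
    u = tilt t (x , y)
    a≡[a+b]-b : ∀ a b → a ≡ (a ℚ.+ b) ℚ.- b
    a≡[a+b]-b = solve 2 (λ a b → a := (a :+ b) :- b) refl
    collect : ∀ s x c t → (s ℚ.* x ℚ.+ c) ℚ.- t ℚ.* x ≡ (s ℚ.- t) ℚ.* x ℚ.+ c
    collect = solve 4 (λ s x c t → (s :* x :+ c) :- t :* x := (s :- t) :* x :+ c) refl
    ι-split : ι y ≡ ι u ℚ.+ ι t ℚ.* ι x
    ι-split = begin
      ι y                   ≡⟨ cong ι (y≡tilt+t*x t x y) ⟩
      ι (u ℤ.+ t ℤ.* x)     ≡⟨ ι-homo-+ u (t ℤ.* x) ⟩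
      ι u ℚ.+ ι (t ℤ.* x)   ≡⟨ cong (ι u ℚ.+_) (ι-homo-* t x) ⟩
      ι u ℚ.+ ι t ℚ.* ι x   ∎

  onLine-x-injective : ∀ {P Q} → OnLine s c P → OnLine s c Q → proj₁ P ≡ proj₁ Q → P ≡ Q
  onLine-x-injective {P = x , y₁} {Q = .x , y₂} onP onQ refl =
    cong (x ,_) (ι-injective (trans onP (sym onQ)))

  module _ (t : ℤ) (t<s : ι t ℚ.< s) where

    tilt-strictMono-onLine : ∀ {P Q} → OnLine s c P → OnLine s c Q →
                             proj₁ P ℤ.< proj₁ Q → tilt t P ℤ.< tilt t Q
    tilt-strictMono-onLine {x₁ , y₁} {x₂ , y₂} onP onQ x₁<x₂ = ι-cancel-<
      (subst₂ ℚ._<_ (sym (ι-tilt-onLine t x₁ y₁ onP)) (sym (ι-tilt-onLine t x₂ y₂ onQ))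
        (ℚP.+-monoˡ-< c (ℚP.*-monoʳ-<-pos (s ℚ.- ι t) {{ℚ.positive (p<q⇒0<q-p t<s)}}
          (ι-mono-< x₁<x₂))))

    tilt-injective-onLine : ∀ {P Q} → OnLine s c P → OnLine s c Q →
                            tilt t P ≡ tilt t Q → P ≡ Q
    tilt-injective-onLine {P@(_ , _)} {Q@(_ , _)} onP onQ tiltP≡tiltQ
      with ℤP.<-cmp (proj₁ P) (proj₁ Q)
    ... | tri< xP<xQ _ _ =
      ⊥-elim (ℤP.<-irrefl tiltP≡tiltQ (tilt-strictMono-onLine {P} {Q} onP onQ xP<xQ))
    ... | tri≈ _ xP≡xQ _ = onLine-x-injective {P} {Q} onP onQ xP≡xQ
    ... | tri> _ _ xQ<xP =
      ⊥-elim (ℤP.<-irrefl (sym tiltP≡tiltQ) (tilt-strictMono-onLine {Q} {P} onQ onP xQ<xP))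

    tilt-mono-onLine : ∀ {P Q} → OnLine s c P → OnLine s c Q →
                       proj₁ P ℤ.≤ proj₁ Q → tilt t P ℤ.≤ tilt t Q
    tilt-mono-onLine {P@(_ , _)} {Q@(_ , _)} onP onQ xP≤xQ
      with ℤP.<-cmp (proj₁ P) (proj₁ Q)
    ... | tri< xP<xQ _ _ = ℤP.<⇒≤ (tilt-strictMono-onLine {P} {Q} onP onQ xP<xQ)
    ... | tri≈ _ xP≡xQ _ =
      ℤP.≤-reflexive (cong (tilt t) (onLine-x-injective {P} {Q} onP onQ xP≡xQ))
    ... | tri> _ _ xQ<xP = ⊥-elim (ℤP.<⇒≱ xQ<xP xP≤xQ)

tilt-after-step : ∀ t p j {d} → stepAt p j ≡ d → tilt t (p (suc j)) ≡ tilt t (p j) ℤ.+ tilt t d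
tilt-after-step t p j refl = tilt-⊖ t (p (suc j)) (p j)

x-after-step : ∀ p j {d} → stepAt p j ≡ d → proj₁ (p (suc j)) ≡ proj₁ (p j) ℤ.+ proj₁ d
x-after-step p j refl = x-⊖ (p (suc j)) (p j)

induction-between : ∀ {ℓ} (P : ℕ → Set ℓ) {i m} → P i →
                    (∀ {j} → suc j ℕ.≤ m → P j → P (suc j)) →
                    ∀ {j} → i ℕ.≤ j → j ℕ.≤ m → P j
induction-between P {i} {m} base step i≤j j≤m = go (ℕP.≤⇒≤′ i≤j) j≤m
  where
  go : ∀ {j} → i ≤′ j → j ℕ.≤ m → P j
  go ≤′-refl         _     = base
  go (≤′-step i≤′j) 1+j≤m = step 1+j≤m (go i≤′j (ℕP.<⇒≤ 1+j≤m))

x-mono : ∀ {m p} → IsNEPath m p → ∀ {i j} → i ℕ.≤ j → j ℕ.≤ m → proj₁ (p i) ℤ.≤ proj₁ (p j)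
x-mono {m} {p} path {i} = induction-between (λ j → proj₁ (p i) ℤ.≤ proj₁ (p j)) ℤP.≤-refl
  (λ 1+j≤m xᵢ≤xⱼ → ℤP.≤-trans xᵢ≤xⱼ (x-step 1+j≤m))
  where
  x-step : ∀ {j} → j ℕ.< m → proj₁ (p j) ℤ.≤ proj₁ (p (suc j))
  x-step {j} j<m with path j j<m
  ... | inj₁ east-step  =
    subst (proj₁ (p j) ℤ.≤_) (sym (x-after-step p j east-step)) (ℤP.i≤i+j _ (+ 1))
  ... | inj₂ north-step =
    subst (proj₁ (p j) ℤ.≤_) (sym (x-after-step p j north-step)) (ℤP.i≤i+j _ (+ 0))

NorthRun : (ℕ → Point) → ℕ → ℕ → Set
NorthRun p start length = ∀ q → q ℕ.< length → stepAt p (start ℕ.+ q) ≡ north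

northRun-extend : ∀ p {start length} → NorthRun p start length →
                  stepAt p (start ℕ.+ length) ≡ north → NorthRun p start (suc length)
northRun-extend p run last-north q q<1+length with ℕP.m<1+n⇒m<n∨m≡n q<1+length
... | inj₁ q<length = run q q<length
... | inj₂ refl     = last-north

northRun⇒HasRun : ∀ {m n} p start → NorthRun p start (suc n) →
                  start ℕ.+ suc n ℕ.≤ m → HasRun (suc (suc n)) m p
northRun⇒HasRun p start run fits = start , fits , λ q q<1+n → trans (run q q<1+n) (sym first-north)
  where
  first-north : stepAt p start ≡ north
  first-north = subst (λ i → stepAt p i ≡ north) (ℕP.+-identityʳ start) (run 0 ℕ.z<s)

module _ {m n : ℕ} {p : ℕ → Point}
         (path : IsNEPath m p) (noRun : ¬ HasRun (suc (suc n)) m p) where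

  private
    ψ : ℕ → ℤ
    ψ j = tilt (+ n) (p j)

  northRun-bounded : ∀ {start length} → NorthRun p start length →
                     start ℕ.+ length ℕ.≤ m → length ℕ.≤ n
  northRun-bounded {start} {length} run fits with length ℕ.≤? n
  ... | yes length≤n = length≤n
  ... | no  length≰n = ⊥-elim (noRun (northRun⇒HasRun p start prefix prefix-fits))
    where
    n<length = ℕP.≰⇒> length≰n
    prefix : NorthRun p start (suc n)
    prefix q q<1+n = run q (ℕP.<-≤-trans q<1+n n<length)
    prefix-fits = ℕP.≤-trans (ℕP.+-monoʳ-≤ start n<length) fits

  -- An east step ends the current north run and, as that run had length at
  -- most n, pulls ψ back down to at most ψ i.
  record RunBound (i j : ℕ) : Set where
    constructor runBound
    field
      start length : ℕ
      north-run    : NorthRun p start length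
      ends-at-j    : start ℕ.+ length ≡ j
      ψ-bound      : ψ j ℤ.≤ ψ i ℤ.+ + length

  ψ-after-east : ∀ {i j r} → stepAt p j ≡ east → ψ j ℤ.≤ ψ i ℤ.+ + r → r ℕ.≤ n →
                 ψ (suc j) ℤ.≤ ψ i ℤ.+ + 0
  ψ-after-east {i} {j} {r} east-step ψⱼ≤ψᵢ+r r≤n = begin
    ψ (suc j)                ≡⟨ tilt-after-step (+ n) p j east-step ⟩
    ψ j ℤ.+ tilt (+ n) east  ≡⟨ cong (λ d → ψ j ℤ.+ d) (tilt-east (+ n)) ⟩
    ψ j ℤ.- + n              ≤⟨ ℤP.+-monoˡ-≤ (ℤ.- + n) ψⱼ≤ψᵢ+n ⟩
    (ψ i ℤ.+ + n) ℤ.- + n    ≡⟨ [a+b]-b≡a (ψ i) (+ n) ⟩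
    ψ i                      ≡⟨ ℤP.+-identityʳ (ψ i) ⟨
    ψ i ℤ.+ + 0              ∎
    where
    open ℤP.≤-Reasoning
    ψⱼ≤ψᵢ+n = ℤP.≤-trans ψⱼ≤ψᵢ+r (ℤP.+-monoʳ-≤ (ψ i) (ℤ.+≤+ r≤n))

  ψ-after-north : ∀ {i j r} → stepAt p j ≡ north → ψ j ℤ.≤ ψ i ℤ.+ + r →
                  ψ (suc j) ℤ.≤ ψ i ℤ.+ + suc r
  ψ-after-north {i} {j} {r} north-step ψⱼ≤ψᵢ+r = begin
    ψ (suc j)                 ≡⟨ tilt-after-step (+ n) p j north-step ⟩
    ψ j ℤ.+ tilt (+ n) north  ≡⟨ cong (λ d → ψ j ℤ.+ d) (tilt-north (+ n)) ⟩
    ψ j ℤ.+ + 1               ≤⟨ ℤP.+-monoˡ-≤ (+ 1) ψⱼ≤ψᵢ+r ⟩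
    (ψ i ℤ.+ + r) ℤ.+ + 1     ≡⟨ ℤP.+-assoc (ψ i) (+ r) (+ 1) ⟩
    ψ i ℤ.+ + (r ℕ.+ 1)       ≡⟨ cong (λ k → ψ i ℤ.+ + k) (ℕP.+-comm r 1) ⟩
    ψ i ℤ.+ + suc r           ∎
    where open ℤP.≤-Reasoning

  runBound-refl : ∀ i → RunBound i i
  runBound-refl i =
    runBound i 0 (λ _ ()) (ℕP.+-identityʳ i) (ℤP.≤-reflexive (sym (ℤP.+-identityʳ (ψ i))))

  runBound-step : ∀ {i j} → suc j ℕ.≤ m → RunBound i j → RunBound i (suc j)
  runBound-step 1+j≤m (runBound start length run refl ψ≤) with path (start ℕ.+ length) 1+j≤m
  ... | inj₁ east-step  = runBound (suc (start ℕ.+ length)) 0 (λ _ ()) (ℕP.+-identityʳ _)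
                            (ψ-after-east east-step ψ≤ (northRun-bounded run (ℕP.<⇒≤ 1+j≤m)))
  ... | inj₂ north-step = runBound start (suc length) (northRun-extend p run north-step)
                            (ℕP.+-suc start length) (ψ-after-north north-step ψ≤)

  tilt-bound : ∀ {i j} → i ℕ.≤ j → j ℕ.≤ m → tilt (+ n) (p j) ℤ.≤ tilt (+ n) (p i) ℤ.+ + n
  tilt-bound {i} i≤j j≤m = ℤP.≤-trans ψ-bound (ℤP.+-monoʳ-≤ (ψ i) (ℤ.+≤+ length≤n))
    where
    open RunBound (induction-between (RunBound i) (runBound-refl i) runBound-step i≤j j≤m)
    length≤n = northRun-bounded north-run (subst (ℕ._≤ m) (sym ends-at-j) j≤m)

injective-in-window⇒≤ : ∀ {k} (f : Fin k → ℤ) (lo : ℤ) (n : ℕ) →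
                         (∀ a b → f a ≡ f b → a ≡ b) →
                         (∀ a → lo ℤ.≤ f a × f a ℤ.≤ lo ℤ.+ + n) → k ℕ.≤ suc n
injective-in-window⇒≤ f lo n f-injective in-window = FinP.injective⇒≤ slot-injective
  where
  offset : ∀ a → + ℤ.∣ f a ℤ.- lo ∣ ≡ f a ℤ.- lo
  offset a = ℤP.0≤i⇒+∣i∣≡i (ℤP.i≤j⇒0≤j-i (proj₁ (in-window a)))
  offset≤n : ∀ a → ℤ.∣ f a ℤ.- lo ∣ ℕ.≤ n
  offset≤n a = ℤ.drop‿+≤+ (subst₂ ℤ._≤_ (sym (offset a)) ([a+b]-a≡b lo (+ n))
                 (ℤP.+-monoˡ-≤ (ℤ.- lo) (proj₂ (in-window a))))
  slot : ∀ a → Fin (suc n)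
  slot a = fromℕ< (s≤s (offset≤n a))
  slot-injective : ∀ {a b} → slot a ≡ slot b → a ≡ b
  slot-injective {a} {b} same-slot = f-injective a b (begin
    f a                   ≡⟨ [a-b]+b≡a (f a) lo ⟨
    (f a ℤ.- lo) ℤ.+ lo   ≡⟨ cong (ℤ._+ lo) same-offset ⟩
    (f b ℤ.- lo) ℤ.+ lo   ≡⟨ [a-b]+b≡a (f b) lo ⟩
    f b                   ∎)
    where
    open ≡-Reasoning
    same-offset : f a ℤ.- lo ≡ f b ℤ.- lo
    same-offset = begin
      f a ℤ.- lo                ≡⟨ offset a ⟨
      + ℤ.∣ f a ℤ.- lo ∣         ≡⟨ cong +_ (FinP.toℕ-fromℕ< _) ⟨
      + Fin.toℕ (slot a)        ≡⟨ cong (λ i → + Fin.toℕ i) same-slot ⟩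
      + Fin.toℕ (slot b)        ≡⟨ cong +_ (FinP.toℕ-fromℕ< _) ⟩
      + ℤ.∣ f b ℤ.- lo ∣         ≡⟨ offset b ⟩
      f b ℤ.- lo                ∎

proposition1 : (k : ℕ) → k ≥ 1 → (m : ℕ) → (p : ℕ → Point) →
    IsNEPath m p → ¬ HasRun k m p →
    (s : ℚ) → s > ι (+ k - + 2) → (c : ℚ) → ¬ LineContains k m p s c
proposition1 (suc zero) _ _ _ _ noRun _ _ _ _ = noRun (0 , z≤n , λ _ ())
proposition1 (suc (suc n)) _ m p path noRun s n<s c (idx , idx≤m , distinct , onLine) =
  ℕP.<-irrefl refl (injective-in-window⇒≤ ψ (ψ first) n ψ-injective in-window)
  where
  -- n<s : ι (+ n) ℚ.< s, since + (2 + n) - + 2 reduces to + n.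
  open OnLineLemmas s c
  ψ : Fin (suc (suc n)) → ℤ
  ψ a = tilt (+ n) (p (idx a))
  ψ-injective : ∀ a b → ψ a ≡ ψ b → a ≡ b
  ψ-injective a b =
    distinct a b ∘ tilt-injective-onLine (+ n) n<s {p (idx a)} {p (idx b)} (onLine a) (onLine b)
  first : Fin (suc (suc n))
  first = argmin idx Fin.zero (allFin _)
  first-earliest : ∀ a → idx first ℕ.≤ idx a
  first-earliest a = All.lookup (f[argmin]≤f[xs] {f = idx} Fin.zero (allFin _)) (∈-allFin a)
  in-window : ∀ a → ψ first ℤ.≤ ψ a × ψ a ℤ.≤ ψ first ℤ.+ + n
  in-window a =
    tilt-mono-onLine (+ n) n<s {p (idx first)} {p (idx a)} (onLine first) (onLine a)
      (x-mono {p = p} path (first-earliest a) (idx≤m a)) ,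
    tilt-bound {p = p} path noRun (first-earliest a) (idx≤m a)
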